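{- Let $e$ be a central element of a Łukasiewicz near semiring $\mathbf A$. Then the least ideal $I(e)$ containing $e$ equals the interval $[0,e]=\{x\in A: x\le e\}$.
   Context: An $\iota$-near semiring is an algebra $\mathbf A=\langle A,+,\cdot,{}^{\alpha},0,1\rangle$ of type $\langle 2,2,1,0,0\rangle$ such that $\langle A,+\rangle$ is a join semilattice with least element $0$ and greatest element $1$ (order $x\le y$ iff $x+y=y$), $x\cdot1=x=1\cdot x$, $(x+y)\cdot z=xz+yz$, $x0=0x=0$, $(x^{\alpha})^{\alpha}=x$, and $x\le y$ implies $y^{\alpha}\le x^{\alpha}$. A Łukasiewicz near semiring is an $\iota$-near semiring satisfying $(x y^{\alpha})^{\alpha} y^{\alpha}=(y x^{\alpha})^{\alpha} x^{\alpha}$. Juxtaposition $xy$ denotes $x\cdot y$. An ideal of $\mathbf A$ is a set $I\subseteq A$ with $0\in I$ such that (I1) if $ab^{\alpha}\in I$ and $b\in I$ then $a\in I$; (I2) if $a^{\alpha}b\in I$ and $b^{\alpha}a\in I$ then $(ac)^{\alpha}(bc)\in I$ and $(ca)^{\alpha}(cb)\in I$ for every $c\in A$. An element $e\in A$ is central if the principal congruences $\theta(e,0)$ and $\theta(e,1)$ form a pair of factor congruences: $\theta(e,0)\cap\theta(e,1)$ is the identity relation and $\theta(e,0)\circ\theta(e,1)=A\times A$. -}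

module Defs where

open import Level using (Level; 0ℓ) renaming (suc to lsuc)
open import Data.Product using (Σ; _×_; _,_; ∃)
open import Relation.Binary.PropositionalEquality using (_≡_)

record IotaNearSemiring : Set₁ where
  infixl 6 _+_
  infixl 7 _·_
  infix 4 _≤_
  field
    Carrier : Set
    _+_     : Carrier → Carrier → Carrier
    _·_     : Carrier → Carrier → Carrier
    _ᵅ      : Carrier → Carrier
    𝟘       : Carrier
    𝟙       : Carrier

  _≤_ : Carrier → Carrier → Set
  x ≤ y = x + y ≡ y

  field
    +-assoc   : ∀ x y z → (x + y) + z ≡ x + (y + z)
    +-comm    : ∀ x y → x + y ≡ y + x
    +-idem    : ∀ x → x + x ≡ x
    +-identity : ∀ x → 𝟘 + x ≡ x
    +-top     : ∀ x → x + 𝟙 ≡ 𝟙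
    ·-identityʳ : ∀ x → x · 𝟙 ≡ x
    ·-identityˡ : ∀ x → 𝟙 · x ≡ x
    ·-distribʳ : ∀ x y z → (x + y) · z ≡ x · z + y · z
    ·-zeroʳ : ∀ x → x · 𝟘 ≡ 𝟘
    ·-zeroˡ : ∀ x → 𝟘 · x ≡ 𝟘
    ᵅ-invol : ∀ x → (x ᵅ) ᵅ ≡ x
    ᵅ-antitone : ∀ x y → x ≤ y → y ᵅ ≤ x ᵅ

record ŁukasiewiczNearSemiring : Set₁ where
  field
    ins : IotaNearSemiring
  open IotaNearSemiring ins public
  field
    łuk : ∀ x y → ((x · (y ᵅ)) ᵅ) · (y ᵅ) ≡ ((y · (x ᵅ)) ᵅ) · (x ᵅ)

module _ (A : ŁukasiewiczNearSemiring) where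
  open ŁukasiewiczNearSemiring A

  Rel : Set₁
  Rel = Carrier → Carrier → Set

  -- Congruence: equivalence relation compatible with all basic operations
  -- (compatibility with the constants is automatic).
  record IsCongruence (θ : Rel) : Set where
    field
      refl′  : ∀ x → θ x x
      sym′   : ∀ {x y} → θ x y → θ y x
      trans′ : ∀ {x y z} → θ x y → θ y z → θ x z
      +-cong : ∀ {x x′ y y′} → θ x x′ → θ y y′ → θ (x + y) (x′ + y′)
      ·-cong : ∀ {x x′ y y′} → θ x x′ → θ y y′ → θ (x · y) (x′ · y′)
      ᵅ-cong : ∀ {x x′} → θ x x′ → θ (x ᵅ) (x′ ᵅ)

  -- Principal congruence θ(a,b): the least congruence containing (a,b),
  -- defined as the intersection of all congruences containing (a,b).
  θ⟨_,_⟩ : Carrier → Carrier → Carrier → Carrier → Set₁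
  θ⟨ a , b ⟩ x y = (R : Rel) → IsCongruence R → R a b → R x y

  -- e is central: θ(e,0), θ(e,1) are a pair of factor congruences
  IsCentral : Carrier → Set₁
  IsCentral e =
    (∀ x y → θ⟨ e , 𝟘 ⟩ x y → θ⟨ e , 𝟙 ⟩ x y → x ≡ y)
    × (∀ x y → ∃ λ z → θ⟨ e , 𝟘 ⟩ x z × θ⟨ e , 𝟙 ⟩ z y)

  Pred : Set₁
  Pred = Carrier → Set

  record IsIdeal (I : Pred) : Set where
    field
      zero∈ : I 𝟘
      I1 : ∀ a b → I (a · (b ᵅ)) → I b → I a
      I2 : ∀ a b → I ((a ᵅ) · b) → I ((b ᵅ) · a) → ∀ c →
             I (((a · c) ᵅ) · (b · c)) × I (((c · a) ᵅ) · (c · b))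

  I⟨_⟩ : Carrier → Carrier → Set₁
  I⟨ e ⟩ x = (I : Pred) → IsIdeal I → I e → I x

module Submission where

-- The inclusion [0,e] ⊆ I(e) holds for every element: ideals are down-closed,
-- because x ≤ y forces x·yᵅ = 0, and axiom (I1) then gives x from y.
--
-- For I(e) ⊆ [0,e] it suffices that [0,e] is itself an ideal.  The key
-- observation is that the kernel {x : x θ 0} of ANY congruence θ satisfies the
-- ideal axioms (I1) and (I2); for (I2) one needs that a congruence is
-- determined by its kernel, which is where the Łukasiewicz identity enters.
-- For a central e, the kernel of the principal congruence θ(e,0) is exactly
-- [0,e]: kernels are down-closed, and conversely x θ(e,0) 0 together with
-- x+e θ(e,1) e gives (x+e, e) ∈ θ(e,0) ∩ θ(e,1) = Δ.  Hence [0,e] inherits the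
-- ideal axioms from the kernel of θ(e,0).

open import Defs
open import Level using (0ℓ)
open import Data.Product using (_×_; _,_; proj₁; proj₂)
open import Relation.Binary.Bundles using (Setoid)
open import Relation.Binary.PropositionalEquality using (_≡_; sym; trans; cong; subst)
import Relation.Binary.Reasoning.Setoid as SetoidReasoning

module Arithmetic (A : ŁukasiewiczNearSemiring) where
  open ŁukasiewiczNearSemiring A
  open Relation.Binary.PropositionalEquality.≡-Reasoning

  𝟙-absorbs : ∀ x → 𝟙 + x ≡ 𝟙
  𝟙-absorbs x = trans (+-comm 𝟙 x) (+-top x)

  ᵅ-𝟘 : 𝟘 ᵅ ≡ 𝟙
  ᵅ-𝟘 = begin
    𝟘 ᵅ             ≡⟨ sym (ᵅ-antitone 𝟘 (𝟙 ᵅ) (+-identity (𝟙 ᵅ))) ⟩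
    (𝟙 ᵅ) ᵅ + 𝟘 ᵅ   ≡⟨ cong (_+ 𝟘 ᵅ) (ᵅ-invol 𝟙) ⟩
    𝟙 + 𝟘 ᵅ         ≡⟨ 𝟙-absorbs (𝟘 ᵅ) ⟩
    𝟙               ∎

  ᵅ-𝟙 : 𝟙 ᵅ ≡ 𝟘
  ᵅ-𝟙 = trans (cong _ᵅ (sym ᵅ-𝟘)) (ᵅ-invol 𝟘)

  -- x · xᵅ = 0: the Łukasiewicz identity with y = 1.
  ·-ᵅʳ : ∀ x → x · x ᵅ ≡ 𝟘
  ·-ᵅʳ x = begin
    x · x ᵅ                 ≡⟨ cong (_· x ᵅ) (sym (ᵅ-invol x)) ⟩
    (x ᵅ) ᵅ · x ᵅ           ≡⟨ cong (λ t → t ᵅ · x ᵅ) (sym (·-identityˡ (x ᵅ))) ⟩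
    (𝟙 · x ᵅ) ᵅ · x ᵅ       ≡⟨ sym (łuk x 𝟙) ⟩
    (x · 𝟙 ᵅ) ᵅ · 𝟙 ᵅ       ≡⟨ cong ((x · 𝟙 ᵅ) ᵅ ·_) ᵅ-𝟙 ⟩
    (x · 𝟙 ᵅ) ᵅ · 𝟘         ≡⟨ ·-zeroʳ _ ⟩
    𝟘                       ∎

  ·-ᵅˡ : ∀ x → x ᵅ · x ≡ 𝟘
  ·-ᵅˡ x = trans (cong (x ᵅ ·_) (sym (ᵅ-invol x))) (·-ᵅʳ (x ᵅ))

  łuk-sym : ∀ a b → (a ᵅ · b) ᵅ · b ≡ (b ᵅ · a) ᵅ · a
  łuk-sym a b = begin
    (a ᵅ · b) ᵅ · b                 ≡⟨ cong (λ t → (a ᵅ · t) ᵅ · t) (sym (ᵅ-invol b)) ⟩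
    (a ᵅ · (b ᵅ) ᵅ) ᵅ · (b ᵅ) ᵅ     ≡⟨ łuk (a ᵅ) (b ᵅ) ⟩
    (b ᵅ · (a ᵅ) ᵅ) ᵅ · (a ᵅ) ᵅ     ≡⟨ cong (λ t → (b ᵅ · t) ᵅ · t) (ᵅ-invol a) ⟩
    (b ᵅ · a) ᵅ · a                 ∎

  ≤⇒·ᵅ≡𝟘 : ∀ {x y} → x ≤ y → x · y ᵅ ≡ 𝟘
  ≤⇒·ᵅ≡𝟘 {x} {y} x≤y = begin
    x · y ᵅ                 ≡⟨ sym (trans (+-comm _ _) (+-identity _)) ⟩
    x · y ᵅ + 𝟘             ≡⟨ cong (x · y ᵅ +_) (sym (·-ᵅʳ y)) ⟩
    x · y ᵅ + y · y ᵅ       ≡⟨ sym (·-distribʳ x y (y ᵅ)) ⟩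
    (x + y) · y ᵅ           ≡⟨ cong (_· y ᵅ) x≤y ⟩
    y · y ᵅ                 ≡⟨ ·-ᵅʳ y ⟩
    𝟘                       ∎

module Ideal (A : ŁukasiewiczNearSemiring) {I : Pred A} (isIdeal : IsIdeal A I) where
  open ŁukasiewiczNearSemiring A
  open IsIdeal isIdeal
  open Arithmetic A

  ideal-downward : ∀ {x y} → x ≤ y → I y → I x
  ideal-downward {x} {y} x≤y y∈I = I1 x y (subst I (sym (≤⇒·ᵅ≡𝟘 x≤y)) zero∈) y∈I

module Congruence (A : ŁukasiewiczNearSemiring) {R : Rel A} (isCong : IsCongruence A R) where
  open ŁukasiewiczNearSemiring A
  open IsCongruence isCong
  open Arithmetic A

  R-setoid : Setoid 0ℓ 0ℓ
  R-setoid = record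
    { Carrier = Carrier
    ; _≈_ = R
    ; isEquivalence = record { refl = refl′ _ ; sym = sym′ ; trans = trans′ }
    }

  open SetoidReasoning R-setoid

  -- The kernel is a down-set: xᵅ = yᵅ + xᵅ is congruent to 0ᵅ + xᵅ = 1.
  kernel-downward : ∀ {x y} → x ≤ y → R y 𝟘 → R x 𝟘
  kernel-downward {x} {y} x≤y y~𝟘 = begin
    x                   ≡⟨ sym (ᵅ-invol x) ⟩
    (x ᵅ) ᵅ             ≡⟨ cong _ᵅ (sym (ᵅ-antitone x y x≤y)) ⟩
    (y ᵅ + x ᵅ) ᵅ       ≈⟨ ᵅ-cong (+-cong (ᵅ-cong y~𝟘) (refl′ (x ᵅ))) ⟩
    (𝟘 ᵅ + x ᵅ) ᵅ       ≡⟨ cong (λ t → (t + x ᵅ) ᵅ) ᵅ-𝟘 ⟩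
    (𝟙 + x ᵅ) ᵅ         ≡⟨ cong _ᵅ (𝟙-absorbs (x ᵅ)) ⟩
    𝟙 ᵅ                 ≡⟨ ᵅ-𝟙 ⟩
    𝟘                   ∎

  -- The kernel satisfies (I1): a = a·1 is congruent to a·bᵅ when b is in the kernel.
  kernel-I1 : ∀ {a b} → R (a · b ᵅ) 𝟘 → R b 𝟘 → R a 𝟘
  kernel-I1 {a} {b} abᵅ~𝟘 b~𝟘 = begin
    a           ≡⟨ sym (·-identityʳ a) ⟩
    a · 𝟙       ≡⟨ cong (a ·_) (sym ᵅ-𝟘) ⟩
    a · 𝟘 ᵅ     ≈⟨ ·-cong (refl′ a) (ᵅ-cong (sym′ b~𝟘)) ⟩
    a · b ᵅ     ≈⟨ abᵅ~𝟘 ⟩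
    𝟘           ∎

  -- A congruence is determined by its kernel: if aᵅb and bᵅa are in the
  -- kernel then a R b.  This is where the Łukasiewicz identity is used.
  kernel-separates : ∀ {a b} → R (a ᵅ · b) 𝟘 → R (b ᵅ · a) 𝟘 → R a b
  kernel-separates {a} {b} aᵅb~𝟘 bᵅa~𝟘 = begin
    a                   ≡⟨ sym (·-identityˡ a) ⟩
    𝟙 · a               ≡⟨ cong (_· a) (sym ᵅ-𝟘) ⟩
    𝟘 ᵅ · a             ≈⟨ ·-cong (ᵅ-cong (sym′ bᵅa~𝟘)) (refl′ a) ⟩
    (b ᵅ · a) ᵅ · a     ≡⟨ sym (łuk-sym a b) ⟩
    (a ᵅ · b) ᵅ · b     ≈⟨ ·-cong (ᵅ-cong aᵅb~𝟘) (refl′ b) ⟩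
    𝟘 ᵅ · b             ≡⟨ cong (_· b) ᵅ-𝟘 ⟩
    𝟙 · b               ≡⟨ ·-identityˡ b ⟩
    b                   ∎

  -- The kernel satisfies (I2): a R b, so (ac)ᵅ(bc) is congruent to (bc)ᵅ(bc) = 0.
  kernel-I2 : ∀ {a b} → R (a ᵅ · b) 𝟘 → R (b ᵅ · a) 𝟘 → ∀ c →
              R ((a · c) ᵅ · (b · c)) 𝟘 × R ((c · a) ᵅ · (c · b)) 𝟘
  kernel-I2 {a} {b} aᵅb~𝟘 bᵅa~𝟘 c =
      (begin
        (a · c) ᵅ · (b · c)   ≈⟨ ·-cong (ᵅ-cong (·-cong a~b (refl′ c))) (refl′ _) ⟩
        (b · c) ᵅ · (b · c)   ≡⟨ ·-ᵅˡ (b · c) ⟩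
        𝟘                     ∎)
    , (begin
        (c · a) ᵅ · (c · b)   ≈⟨ ·-cong (ᵅ-cong (·-cong (refl′ c) a~b)) (refl′ _) ⟩
        (c · b) ᵅ · (c · b)   ≡⟨ ·-ᵅˡ (c · b) ⟩
        𝟘                     ∎)
    where
    a~b : R a b
    a~b = kernel-separates aᵅb~𝟘 bᵅa~𝟘

  join-kernel : ∀ {x y} → R x 𝟘 → R y 𝟘 → R (x + y) y
  join-kernel {x} {y} x~𝟘 y~𝟘 = begin
    x + y     ≈⟨ +-cong x~𝟘 y~𝟘 ⟩
    𝟘 + 𝟘     ≡⟨ +-identity 𝟘 ⟩
    𝟘         ≈⟨ sym′ y~𝟘 ⟩
    y         ∎

  join-top : ∀ x {y} → R y 𝟙 → R (x + y) y
  join-top x {y} y~𝟙 = begin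
    x + y     ≈⟨ +-cong (refl′ x) y~𝟙 ⟩
    x + 𝟙     ≡⟨ +-top x ⟩
    𝟙         ≈⟨ sym′ y~𝟙 ⟩
    y         ∎

module Central (A : ŁukasiewiczNearSemiring) {e : ŁukasiewiczNearSemiring.Carrier A}
               (central : IsCentral A e) where
  open ŁukasiewiczNearSemiring A
  open Congruence A

  below⇒kernel : ∀ {x} → x ≤ e → θ⟨_,_⟩ A e 𝟘 x 𝟘
  below⇒kernel x≤e R isCong e~𝟘 = kernel-downward isCong x≤e e~𝟘

  -- x θ(e,0) 0 gives (x+e, e) in both θ(e,0) and θ(e,1); these meet in the identity.
  kernel⇒below : ∀ {x} → θ⟨_,_⟩ A e 𝟘 x 𝟘 → x ≤ e
  kernel⇒below {x} x~𝟘 = proj₁ central (x + e) e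
    (λ R isCong e~𝟘 → join-kernel isCong (x~𝟘 R isCong e~𝟘) e~𝟘)
    (λ R isCong e~𝟙 → join-top isCong x e~𝟙)

  -- Each ideal axiom for [0,e] is the corresponding kernel property of θ(e,0).
  below-isIdeal : IsIdeal A (_≤ e)
  below-isIdeal = record { zero∈ = +-identity e ; I1 = below-I1 ; I2 = below-I2 }
    where
    below-I1 : ∀ a b → a · b ᵅ ≤ e → b ≤ e → a ≤ e
    below-I1 a b abᵅ≤e b≤e = kernel⇒below λ R isCong e~𝟘 →
      kernel-I1 isCong (below⇒kernel abᵅ≤e R isCong e~𝟘) (below⇒kernel b≤e R isCong e~𝟘)

    below-I2 : ∀ a b → a ᵅ · b ≤ e → b ᵅ · a ≤ e → ∀ c →
               (a · c) ᵅ · (b · c) ≤ e × (c · a) ᵅ · (c · b) ≤ e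
    below-I2 a b aᵅb≤e bᵅa≤e c =
        kernel⇒below (λ R isCong e~𝟘 → proj₁ (kernel-I2-in R isCong e~𝟘))
      , kernel⇒below (λ R isCong e~𝟘 → proj₂ (kernel-I2-in R isCong e~𝟘))
      where
      kernel-I2-in : ∀ R → IsCongruence A R → R e 𝟘 →
                     R ((a · c) ᵅ · (b · c)) 𝟘 × R ((c · a) ᵅ · (c · b)) 𝟘
      kernel-I2-in R isCong e~𝟘 = kernel-I2 isCong
        (below⇒kernel aᵅb≤e R isCong e~𝟘) (below⇒kernel bᵅa≤e R isCong e~𝟘) c

theorem9 : (A : ŁukasiewiczNearSemiring) → (e : ŁukasiewiczNearSemiring.Carrier A) →
    IsCentral A e →
    ∀ x → (I⟨_⟩ A e x → ŁukasiewiczNearSemiring._≤_ A x e) × (ŁukasiewiczNearSemiring._≤_ A x e → I⟨_⟩ A e x)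
theorem9 A e central x = least-ideal⊆below , below⊆least-ideal
  where
  open ŁukasiewiczNearSemiring A

  -- [0,e] is an ideal containing e, so it contains I(e).
  least-ideal⊆below : I⟨_⟩ A e x → x ≤ e
  least-ideal⊆below x∈I⟨e⟩ = x∈I⟨e⟩ (_≤ e) (Central.below-isIdeal A central) (+-idem e)

  -- Every ideal containing e is down-closed, so contains [0,e].
  below⊆least-ideal : x ≤ e → I⟨_⟩ A e x
  below⊆least-ideal x≤e I isIdeal e∈I = Ideal.ideal-downward A isIdeal x≤e e∈I
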